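{- Let $a,b$ be positive integers with $b>2a$, and let $T_{a,b}=\{C_{i,1}:1\le i\le 2a+1\}\cup\{C_{a+1,j}:2\le j\le b+1\}$, a $T$-shaped polyomino of size $n=2a+b+1$. Then on the $n\times n$ board, $$\mathrm{cp}_{\mathrm{fixed}}(T_{a,b})=\left\lceil \frac{b+1}{2a+1}\right\rceil.$$
   Context: A cell $C_{i,j}$ ($i,j$ integers) is the closed unit square in column $i$ and row $j$ of the integer grid. A polyomino is a finite set of cells; its size is its number of cells. For a polyomino $\mathcal P$ of size $n$, the board is $\mathbb B=\{C_{i,j}:1\le i,j\le n\}$. A shift of $\mathcal P$ by an integer pair $(c,d)$ is $\{C_{x+c,y+d}:C_{x,y}\in\mathcal P\}$; two polyominoes are fixed equivalent if one is a shift of the other. A set of polyominoes is a valid arrangement if all lie in $\mathbb B$ and they are pairwise disjoint. A fixed packing of $\mathcal P$ is a valid arrangement of polyominoes fixed equivalent to $\mathcal P$ such that adding any further polyomino fixed equivalent to $\mathcal P$ yields an invalid arrangement. The clumsy fixed packing number $\mathrm{cp}_{\mathrm{fixed}}(\mathcal P)$ is the minimum number of polyominoes in a fixed packing of $\mathcal P$ on the $n\times n$ board, $n=|\mathcal P|$. -}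

module Defs where

open import Data.Nat as ℕ using (ℕ; suc)
open import Data.Integer as ℤ using (ℤ; +_)
open import Data.Product using (_×_; _,_; ∃-syntax)
open import Data.List using (List; []; _∷_; map; length; upTo; _++_)
open import Data.List.Membership.Propositional using (_∈_)
open import Data.List.Relation.Unary.All using (All)
open import Data.List.Relation.Unary.AllPairs using (AllPairs)
open import Relation.Binary.PropositionalEquality using (_≡_)
open import Relation.Nullary using (¬_)

-- A cell C_{i,j} is identified with its (column, row) integer pair (i , j).
Cell : Set
Cell = ℤ × ℤ

-- A polyomino: a finite set of cells, given as a list of cells
-- (without repetitions; its size is then the length of the list).
Polyomino : Set
Polyomino = List Cell

size : Polyomino → ℕ
size P = length P

_⊕_ : Cell → ℤ × ℤ → Cell
(x , y) ⊕ (c , d) = (x ℤ.+ c , y ℤ.+ d)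

_∈Shift[_,_] : Cell → Polyomino → ℤ × ℤ → Set
z ∈Shift[ P , v ] = ∃[ x ] (x ∈ P × z ≡ x ⊕ v)

InBoard : ℕ → Cell → Set
InBoard n (i , j) = (+ 1 ℤ.≤ i × i ℤ.≤ + n) × (+ 1 ℤ.≤ j × j ℤ.≤ + n)

ShiftInBoard : ℕ → Polyomino → ℤ × ℤ → Set
ShiftInBoard n P v = ∀ z → z ∈Shift[ P , v ] → InBoard n z

DisjointShifts : Polyomino → ℤ × ℤ → ℤ × ℤ → Set
DisjointShifts P u v = ∀ z → ¬ (z ∈Shift[ P , u ] × z ∈Shift[ P , v ])

-- An arrangement of polyominoes fixed equivalent to P (i.e. shifts of P)
-- is recorded as the list of shift vectors of its members.
ValidArrangement : Polyomino → List (ℤ × ℤ) → Set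
ValidArrangement P vs =
  All (ShiftInBoard (size P) P) vs × AllPairs (DisjointShifts P) vs

FixedPacking : Polyomino → List (ℤ × ℤ) → Set
FixedPacking P vs = ValidArrangement P vs × (∀ v → ¬ ValidArrangement P (v ∷ vs))

IsClumsyFixedPackingNumber : Polyomino → ℕ → Set
IsClumsyFixedPackingNumber P k =
  (∃[ vs ] (FixedPacking P vs × length vs ≡ k))
  × (∀ vs → FixedPacking P vs → k ℕ.≤ length vs)

T : ℕ → ℕ → Polyomino
T a b =
  map (λ i → (+ suc i , + 1)) (upTo (suc (2 ℕ.* a)))
  ++ map (λ j → (+ suc a , + (2 ℕ.+ j))) (upTo b)

-- A copy of T on the board is its shift by (c, d) with 0 ≤ c ≤ b and 0 ≤ d ≤ 2a. As the stem is
-- longer than the bar, two copies whose columns are within a of each other always meet, while two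
-- meeting copies have columns within 2a and, unless within a, equal rows. Hence a packing is maximal
-- exactly when every column c ≤ b is within a of the column of some copy: otherwise the positions
-- (c, 0), (c, 1), (c, 2) are blocked by copies in three distinct rows at distance in (a, 2a] from c,
-- two of which lie on the same side of c and therefore meet. Covering the b + 1 columns by windows of
-- width 2a + 1 needs ⌈(b + 1)/(2a + 1)⌉ copies, and copies every 2a + 1 columns, the last one moved
-- up a row, achieve this.
module Submission where

open import Defs
open import Data.Nat using (ℕ; zero; suc; _+_; _*_; _<_; _≤_; z≤n; s≤s; s≤s⁻¹; _/_; _%_; _⊓_)
open import Data.Nat.Properties
open import Data.Nat.DivMod using (m≡m%n+[m/n]*n; m%n<n; m/n*n≤m; m<n*o⇒m/o<n; /-congˡ; +-distrib-/-∣ʳ; n/n≡1)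
open import Data.Nat.Divisibility using (∣-refl)
open import Data.Nat.Tactic.RingSolver using (solve-∀)
open import Data.Fin as Fin using (Fin; punchIn; punchOut)
open import Data.Fin.Properties using (punchIn-punchOut)
open import Data.Integer as ℤ using (ℤ; +_; -[1+_]; +≤+)
open import Data.Integer.Properties using (drop‿+≤+)
open import Data.Product using (∃-syntax; _×_; _,_; proj₁; proj₂; curry; uncurry)
open import Data.Sum using (_⊎_; inj₁; inj₂; [_,_])
open import Data.Empty using (⊥-elim)
open import Function using (_∘_)
open import Data.List using (List; []; _∷_; map; length; upTo; lookup)
open import Data.List.Properties using (length-++; length-map; length-upTo)
open import Data.List.Membership.Propositional using (_∈_; find; lose)
open import Data.List.Membership.Propositional.Properties
  using (∈-map⁺; ∈-map⁻; ∈-++⁺ˡ; ∈-++⁺ʳ; ∈-++⁻; ∈-upTo⁺; ∈-upTo⁻)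
open import Data.List.Relation.Unary.Any as Any using (Any; here; there; any?)
open import Data.List.Relation.Unary.Any.Properties using (lookup-index)
open import Data.List.Relation.Unary.All as All using (All; []; _∷_)
import Data.List.Relation.Unary.All.Properties as All
open import Data.List.Relation.Unary.AllPairs using (AllPairs; _∷_)
import Data.List.Relation.Unary.AllPairs.Properties as AllPairs
open import Relation.Binary.PropositionalEquality using (_≡_; _≢_; refl; sym; trans; cong; cong₂; subst; module ≡-Reasoning)
open import Relation.Nullary using (¬_; Dec; yes; no)
open import Relation.Nullary.Decidable using (_×-dec_; _⊎-dec_)

Near : ℕ → ℕ → ℕ → Set
Near r x y = x ≤ y + r × y ≤ x + r

near? : ∀ r x y → Dec (Near r x y)
near? r x y = (x ≤? y + r) ×-dec (y ≤? x + r)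

Near-sym : ∀ {r x y} → Near r x y → Near r y x
Near-sym (x≤ , y≤) = y≤ , x≤

Near-mono : ∀ {r s x y} → r ≤ s → Near r x y → Near s x y
Near-mono {x = x} {y} r≤s (x≤ , y≤) = ≤-trans x≤ (+-monoʳ-≤ y r≤s) , ≤-trans y≤ (+-monoʳ-≤ x r≤s)

Near-trans : ∀ {r s x y z} → Near r x y → Near s y z → Near (r + s) x z
Near-trans {r} {s} {x} {y} {z} (x≤ , y≤) (y≤′ , z≤) =
  (begin x ≤⟨ x≤ ⟩ y + r ≤⟨ +-monoˡ-≤ r y≤′ ⟩ z + s + r ≡⟨ shuffle z s r ⟩ z + (r + s) ∎) ,
  (begin z ≤⟨ z≤ ⟩ y + s ≤⟨ +-monoˡ-≤ s y≤ ⟩ x + r + s ≡⟨ +-assoc x r s ⟩ x + (r + s) ∎)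
  where
  open ≤-Reasoning
  shuffle : ∀ z s r → z + s + r ≡ z + (r + s)
  shuffle = solve-∀

Near-of-≤ : ∀ {r x y} → x ≤ r → y ≤ r → Near r x y
Near-of-≤ {r} {x} {y} x≤r y≤r = ≤-trans x≤r (m≤n+m r y) , ≤-trans y≤r (m≤n+m r x)

Near-centre : ∀ {r x} → x ≤ 2 * r → Near r x r
Near-centre {r} {x} x≤ = ≤-trans x≤ (≤-reflexive (cong (_+_ r) (+-identityʳ r))) , m≤n+m r x

Near-cancel-+ : ∀ {r i j x y} → i + x ≡ j + y → Near r i j → Near r x y
Near-cancel-+ {r} {i} {j} {x} {y} eq (i≤ , j≤) =
  +-cancelˡ-≤ i x (y + r) (begin i + x ≡⟨ eq ⟩ j + y ≤⟨ +-monoˡ-≤ y j≤ ⟩ i + r + y ≡⟨ shuffle i r y ⟩ i + (y + r) ∎) ,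
  +-cancelˡ-≤ j y (x + r) (begin j + y ≡⟨ eq ⟨ i + x ≤⟨ +-monoˡ-≤ x i≤ ⟩ j + r + x ≡⟨ shuffle j r x ⟩ j + (x + r) ∎)
  where
  open ≤-Reasoning
  shuffle : ∀ i r y → i + r + y ≡ i + (y + r)
  shuffle = solve-∀

Annulus : ℕ → ℕ → ℕ → Set
Annulus r c x = Near (2 * r) c x × ¬ Near r c x

¬Near⇒apart : ∀ {r c x} → ¬ Near r c x → x + r < c ⊎ c + r < x
¬Near⇒apart {r} {c} {x} ¬near with c ≤? x + r
... | no c≰ = inj₁ (≰⇒> c≰)
... | yes c≤ = inj₂ (≰⇒> (¬near ∘ (c≤ ,_)))

module _ {r c : ℕ} where
  private
    2r≡r+r : ∀ y → y + 2 * r ≡ y + r + r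
    2r≡r+r y = trans (cong (_+_ y) (cong (_+_ r) (+-identityʳ r))) (sym (+-assoc y r r))

    below : ∀ {x y} → x + r < c → c ≤ y + 2 * r → x ≤ y + r
    below {x} {y} x+r<c c≤ = +-cancelʳ-≤ r x (y + r) (<⇒≤ (≤-trans x+r<c (≤-trans c≤ (≤-reflexive (2r≡r+r y)))))

    above : ∀ {x y} → x ≤ c + 2 * r → c + r < y → x ≤ y + r
    above {x} {y} x≤ c+r<y = ≤-trans x≤ (≤-trans (≤-reflexive (2r≡r+r c)) (<⇒≤ (+-monoˡ-< r c+r<y)))

  Near-if-below : ∀ {x y} → Near (2 * r) c x → Near (2 * r) c y → x + r < c → y + r < c → Near r x y
  Near-if-below (c≤x+ , _) (c≤y+ , _) x< y< = below x< c≤y+ , below y< c≤x+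

  Near-if-above : ∀ {x y} → Near (2 * r) c x → Near (2 * r) c y → c + r < x → c + r < y → Near r x y
  Near-if-above (_ , x≤c+) (_ , y≤c+) c<x c<y = above x≤c+ c<y , above y≤c+ c<x

  Annulus-pigeonhole : ∀ {x y z} → Annulus r c x → Annulus r c y → Annulus r c z →
                       Near r x y ⊎ Near r x z ⊎ Near r y z
  Annulus-pigeonhole (nx , ¬nx) (ny , ¬ny) (nz , ¬nz) with ¬Near⇒apart ¬nx | ¬Near⇒apart ¬ny | ¬Near⇒apart ¬nz
  ... | inj₁ x< | inj₁ y< | _      = inj₁ (Near-if-below nx ny x< y<)
  ... | inj₂ x> | inj₂ y> | _      = inj₁ (Near-if-above nx ny x> y>)
  ... | inj₁ x< | inj₂ _  | inj₁ z< = inj₂ (inj₁ (Near-if-below nx nz x< z<))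
  ... | inj₂ x> | inj₁ _  | inj₂ z> = inj₂ (inj₁ (Near-if-above nx nz x> z>))
  ... | inj₁ _  | inj₂ y> | inj₂ z> = inj₂ (inj₂ (Near-if-above ny nz y> z>))
  ... | inj₂ _  | inj₁ y< | inj₁ z< = inj₂ (inj₂ (Near-if-below ny nz y< z<))

-- The value covering the top point N - 1 covers nothing below N - (2r+1): drop it and induct.
covering-bound : ∀ r k (f : Fin k → ℕ) N → (∀ {c} → c < N → ∃[ i ] Near r c (f i)) →
                 N ≤ k * suc (2 * r)
covering-bound r zero f zero cover = z≤n
covering-bound r zero f (suc N) cover with () ← proj₁ (cover (s≤s z≤n))
covering-bound r (suc k) f N cover with suc (2 * r) ≤? N
... | no N≱ = ≤-trans (<⇒≤ (≰⇒> N≱)) (m≤m+n (suc (2 * r)) (k * suc (2 * r)))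
... | yes N≥ with m≤n⇒∃[o]m+o≡n N≥
... | N' , refl with cover {2 * r + N'} ≤-refl
... | i₀ , near₀ = +-monoʳ-≤ (suc (2 * r)) (covering-bound r k (f ∘ punchIn i₀) N' cover')
  where
  top-not-near : ∀ {c} → c < N' → ¬ Near (r + r) (2 * r + N') c
  top-not-near {c} c<N' (top≤ , _) = <⇒≱ (begin-strict
    c + (r + r)  <⟨ +-monoˡ-< (r + r) c<N' ⟩
    N' + (r + r) ≡⟨ shuffle N' r ⟩
    2 * r + N'   ∎) top≤
    where
    open ≤-Reasoning
    shuffle : ∀ N' r → N' + (r + r) ≡ 2 * r + N'
    shuffle = solve-∀

  cover' : ∀ {c} → c < N' → ∃[ j ] Near r c (f (punchIn i₀ j))
  cover' {c} c<N' with cover (≤-trans c<N' (m≤n+m N' (suc (2 * r))))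
  ... | i , near with i₀ Fin.≟ i
  ... | yes refl = ⊥-elim (top-not-near c<N' (Near-trans near₀ (Near-sym near)))
  ... | no i₀≢i = punchOut i₀≢i , subst (Near r c ∘ f) (sym (punchIn-punchOut i₀≢i)) near

AllPairs-lookup₂ : ∀ {A : Set} {R : A → A → Set} {xs : List A} {x y : A} →
                   AllPairs R xs → x ∈ xs → y ∈ xs → x ≢ y → R x y ⊎ R y x
AllPairs-lookup₂ (_ ∷ _)   (here refl) (here refl) x≢y = ⊥-elim (x≢y refl)
AllPairs-lookup₂ (rx ∷ _)  (here refl) (there y∈)  _   = inj₁ (All.lookup rx y∈)
AllPairs-lookup₂ (ry ∷ _)  (there x∈)  (here refl) _   = inj₂ (All.lookup ry x∈)
AllPairs-lookup₂ (_ ∷ rxs) (there x∈)  (there y∈)  x≢y = AllPairs-lookup₂ rxs x∈ y∈ x≢y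

Placement : Set
Placement = ℕ × ℕ

place : Placement → ℤ × ℤ
place (c , d) = (+ c , + d)

module _ (a b : ℕ) where

  private
    a≤2a : a ≤ 2 * a
    a≤2a = m≤n*m a 2

  -- T consists of the cells C_{1+i,1+k} with Shape i k: the bar is k = 0, the stem is i = a.
  Shape : ℕ → ℕ → Set
  Shape i k = i ≤ 2 * a × k ≤ b × (k ≡ 0 ⊎ i ≡ a)

  Shape⇒∈T : ∀ {i k} → Shape i k → place (suc i , suc k) ∈ T a b
  Shape⇒∈T (i≤ , _ , inj₁ refl) = ∈-++⁺ˡ (∈-map⁺ _ (∈-upTo⁺ (s≤s i≤)))
  Shape⇒∈T {k = zero} (_ , _ , inj₂ refl) = ∈-++⁺ˡ (∈-map⁺ _ (∈-upTo⁺ (s≤s a≤2a)))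
  Shape⇒∈T {k = suc j} (_ , j<b , inj₂ refl) = ∈-++⁺ʳ _ (∈-map⁺ _ (∈-upTo⁺ j<b))

  ∈T⇒Shape : ∀ {x} → x ∈ T a b → ∃[ i ] ∃[ k ] (x ≡ place (suc i , suc k) × Shape i k)
  ∈T⇒Shape x∈ with ∈-++⁻ (map _ (upTo (suc (2 * a)))) x∈
  ... | inj₁ x∈bar with i , i∈ , refl ← ∈-map⁻ _ x∈bar = i , 0 , refl , s≤s⁻¹ (∈-upTo⁻ i∈) , z≤n , inj₁ refl
  ... | inj₂ x∈stem with j , j∈ , refl ← ∈-map⁻ _ x∈stem = a , suc j , refl , a≤2a , ∈-upTo⁻ j∈ , inj₂ refl

  size-T : size (T a b) ≡ suc (2 * a + b)
  size-T = trans (length-++ (map _ (upTo (suc (2 * a)))))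
             (cong₂ _+_ (trans (length-map _ (upTo (suc (2 * a)))) (length-upTo (suc (2 * a))))
                        (trans (length-map _ (upTo b)) (length-upTo b)))

  Fits : Placement → Set
  Fits (c , d) = c ≤ b × d ≤ 2 * a

  OnBoard : ℤ × ℤ → Set
  OnBoard = ShiftInBoard (size (T a b)) (T a b)

  Fits⇒OnBoard : ∀ {s} → Fits s → OnBoard (place s)
  Fits⇒OnBoard {c , d} (c≤b , d≤2a) z (x , x∈ , refl) with _ , _ , refl , i≤ , k≤ , _ ← ∈T⇒Shape x∈ =
    subst (λ n → InBoard n z) (sym size-T)
      ((+≤+ (s≤s z≤n) , +≤+ (s≤s (+-mono-≤ i≤ c≤b))) ,
       (+≤+ (s≤s z≤n) , +≤+ (s≤s (≤-trans (+-mono-≤ k≤ d≤2a) (≤-reflexive (+-comm b (2 * a)))))))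

  private
    nonneg : ∀ {v} → + 1 ℤ.≤ + 1 ℤ.+ v → ∃[ n ] v ≡ + n
    nonneg {+ n} _ = n , refl
    nonneg { -[1+ zero ]} (+≤+ ())
    nonneg { -[1+ suc _ ]} ()

    below-size : ∀ {n} → + n ℤ.≤ + size (T a b) → n ≤ suc (2 * a + b)
    below-size {n} = subst (n ≤_) size-T ∘ drop‿+≤+

    cell-in-board : ∀ {v i k} → OnBoard v → Shape i k → InBoard (size (T a b)) (place (suc i , suc k) ⊕ v)
    cell-in-board in-board shape = in-board _ (_ , Shape⇒∈T shape , refl)

  -- The cells C_{1,1}, C_{2a+1,1} and C_{a+1,b+1} of T bound the shift from below, right and above.
  OnBoard⇒Fits : ∀ {v} → OnBoard v → ∃[ s ] (v ≡ place s × Fits s)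
  OnBoard⇒Fits {vc , vd} in-board
    with (1≤ , _) , (1≤′ , _) ← cell-in-board in-board (z≤n , z≤n , inj₁ refl)
    with c , refl ← nonneg {vc} 1≤ | d , refl ← nonneg {vd} 1≤′ =
    (c , d) , refl ,
    +-cancelˡ-≤ (2 * a) c b (s≤s⁻¹ (below-size (proj₂ (proj₁ rightmost)))) ,
    +-cancelʳ-≤ b d (2 * a) (≤-trans (≤-reflexive (+-comm d b)) (s≤s⁻¹ (below-size (proj₂ (proj₂ highest)))))
    where
    rightmost = cell-in-board in-board (≤-refl , z≤n , inj₁ refl)
    highest = cell-in-board in-board (a≤2a , ≤-refl , inj₂ refl)

  OnBoard⇒Fits* : ∀ {vs} → All OnBoard vs → ∃[ S ] (vs ≡ map place S × All Fits S)
  OnBoard⇒Fits* [] = [] , refl , []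
  OnBoard⇒Fits* (v-in ∷ vs-in)
    with s , refl , fits ← OnBoard⇒Fits v-in | S , refl , fitsS ← OnBoard⇒Fits* vs-in =
    s ∷ S , refl , fits ∷ fitsS

  Meet : Placement → Placement → Set
  Meet s t = ∃[ z ] (z ∈Shift[ T a b , place s ] × z ∈Shift[ T a b , place t ])

  Meet-sym : ∀ {s t} → Meet s t → Meet t s
  Meet-sym (z , z∈s , z∈t) = z , z∈t , z∈s

  Disjoint : Placement → Placement → Set
  Disjoint s t = DisjointShifts (T a b) (place s) (place t)

  Clash : Placement → Placement → Set
  Clash (c , d) (c' , d') = Near a c c' ⊎ (d ≡ d' × Near (2 * a) c c')

  clash? : ∀ s t → Dec (Clash s t)
  clash? (c , d) (c' , d') = near? a c c' ⊎-dec ((d ≟ d') ×-dec near? (2 * a) c c')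

  private
    coords : ∀ {m n m' n'} → place (m , n) ≡ place (m' , n') → m ≡ m' × n ≡ n'
    coords refl = refl , refl

  -- Two bar cells force equal rows; a stem cell lies in column a+1, the middle of the bar.
  Meet⇒Clash : ∀ {s t} → Meet s t → Clash s t
  Meet⇒Clash (_ , (_ , x∈ , refl) , (_ , y∈ , e)) with ∈T⇒Shape x∈ | ∈T⇒Shape y∈
  ... | _ , _ , refl , i≤ , _ , inj₁ refl | _ , _ , refl , i'≤ , _ , inj₁ refl =
    inj₂ (suc-injective (proj₂ (coords e)) , Near-cancel-+ (suc-injective (proj₁ (coords e))) (Near-of-≤ i≤ i'≤))
  ... | _ , _ , refl , _ , _ , inj₂ refl | _ , _ , refl , i'≤ , _ , _ =
    inj₁ (Near-cancel-+ (suc-injective (proj₁ (coords e))) (Near-sym (Near-centre i'≤)))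
  ... | _ , _ , refl , i≤ , _ , _ | _ , _ , refl , _ , _ , inj₂ refl =
    inj₁ (Near-cancel-+ (suc-injective (proj₁ (coords e))) (Near-centre i≤))

  ¬Clash⇒Disjoint : ∀ {s t} → ¬ Clash s t → Disjoint s t
  ¬Clash⇒Disjoint ¬clash = curry (¬clash ∘ Meet⇒Clash)

  -- The cell C_{a+1+c, 1+d'} lies on the stem of the lower copy and on the bar of the upper one.
  stem-meets-bar : ∀ {c d c' d'} → 2 * a ≤ b → Near a c c' → d ≤ d' → d' ≤ 2 * a → Meet (c , d) (c' , d')
  stem-meets-bar {c} {d} {c'} {d'} 2a≤b (c≤ , c'≤) d≤d' d'≤2a =
    place (suc a + c , suc d') ,
    (_ , Shape⇒∈T (a≤2a , ≤-trans (m∸n≤m d' d) (≤-trans d'≤2a 2a≤b) , inj₂ refl) ,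
         cong (λ n → place (suc a + c , suc n)) (sym (m∸n+n≡m d≤d'))) ,
    (_ , Shape⇒∈T (m≤n+o⇒m∸n≤o (a + c) c' a+c≤c'+2a , z≤n , inj₁ refl) ,
         cong (λ n → place (suc n , suc d')) (sym (m∸n+n≡m (≤-trans c'≤ (≤-reflexive (+-comm c a))))))
    where
    a+c≤c'+2a : a + c ≤ c' + 2 * a
    a+c≤c'+2a = ≤-trans (+-monoʳ-≤ a c≤) (≤-reflexive (shuffle a c'))
      where
      shuffle : ∀ a c' → a + (c' + a) ≡ c' + 2 * a
      shuffle = solve-∀

  Near⇒Meet : ∀ {c d c' d'} → 2 * a ≤ b → Near a c c' → d ≤ 2 * a → d' ≤ 2 * a → Meet (c , d) (c' , d')
  Near⇒Meet {d = d} {d' = d'} 2a≤b near d≤2a d'≤2a with ≤-total d d'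
  ... | inj₁ d≤d' = stem-meets-bar 2a≤b near d≤d' d'≤2a
  ... | inj₂ d'≤d = Meet-sym (stem-meets-bar 2a≤b (Near-sym near) d'≤d d≤2a)

  covering⇒maximal : 2 * a ≤ b → ∀ {S} → All Fits S → (∀ {c} → c ≤ b → Any (Near a c ∘ proj₁) S) →
                     ∀ v → ¬ ValidArrangement (T a b) (v ∷ map place S)
  covering⇒maximal 2a≤b fits covers v ((v-in ∷ _) , (v-disjoint ∷ _))
    with (c , d) , refl , (c≤b , d≤2a) ← OnBoard⇒Fits v-in
    with (c' , d') , s∈ , near ← find (covers c≤b) =
    uncurry (All.lookup v-disjoint (∈-map⁺ place s∈)) (Near⇒Meet 2a≤b near d≤2a (proj₂ (All.lookup fits s∈)))

  module _ (0<a : 0 < a) (2a<b : 2 * a < b) {S : List Placement} (fits : All Fits S)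
           (disjoint : AllPairs Disjoint S) (maximal : ∀ v → ¬ ValidArrangement (T a b) (v ∷ map place S)) where

    private
      2≤2a : 2 ≤ 2 * a
      2≤2a = *-monoʳ-≤ 2 0<a

      1≤2a : 1 ≤ 2 * a
      1≤2a = ≤-trans (n≤1+n 1) 2≤2a

      2a≤b : 2 * a ≤ b
      2a≤b = <⇒≤ 2a<b

      ¬Meet-in-packing : ∀ {s t} → s ∈ S → t ∈ S → s ≢ t → ¬ Meet s t
      ¬Meet-in-packing s∈ t∈ s≢t with AllPairs-lookup₂ disjoint s∈ t∈ s≢t
      ... | inj₁ s-t = uncurry s-t
      ... | inj₂ t-s = uncurry t-s ∘ Meet-sym

      blocked : ∀ {c d} → c ≤ b → d ≤ 2 * a → Any (Clash (c , d)) S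
      blocked {c} {d} c≤b d≤2a with any? (clash? (c , d)) S
      ... | yes clash = clash
      ... | no ¬clash = ⊥-elim (maximal (place (c , d))
            ((Fits⇒OnBoard (c≤b , d≤2a) ∷ All.map⁺ (All.map Fits⇒OnBoard fits)) ,
             (All.map⁺ (All.tabulate (λ s∈ → ¬Clash⇒Disjoint (¬clash ∘ lose s∈))) ∷ AllPairs.map⁺ disjoint)))

      annulus-piece : ∀ {c} d → c ≤ b → d ≤ 2 * a → ¬ Any (Near a c ∘ proj₁) S →
                      ∃[ c' ] ((c' , d) ∈ S × Annulus a c c')
      annulus-piece d c≤b d≤2a uncovered with find (blocked c≤b d≤2a)
      ... | _ , s∈ , inj₁ near = ⊥-elim (uncovered (lose s∈ near))
      ... | (c' , _) , s∈ , inj₂ (refl , near₂) = c' , s∈ , near₂ , uncovered ∘ lose s∈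

    maximal⇒covering : ∀ {c} → c ≤ b → Any (Near a c ∘ proj₁) S
    maximal⇒covering {c} c≤b with any? (near? a c ∘ proj₁) S
    ... | yes covered = covered
    ... | no uncovered
      with c₀ , s₀∈ , A₀ ← annulus-piece 0 c≤b z≤n uncovered
      with c₁ , s₁∈ , A₁ ← annulus-piece 1 c≤b 1≤2a uncovered
      with c₂ , s₂∈ , A₂ ← annulus-piece 2 c≤b 2≤2a uncovered
      with Annulus-pigeonhole A₀ A₁ A₂
    ... | inj₁ near = ⊥-elim (¬Meet-in-packing s₀∈ s₁∈ (λ ()) (Near⇒Meet 2a≤b near z≤n 1≤2a))
    ... | inj₂ (inj₁ near) = ⊥-elim (¬Meet-in-packing s₀∈ s₂∈ (λ ()) (Near⇒Meet 2a≤b near z≤n 2≤2a))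
    ... | inj₂ (inj₂ near) = ⊥-elim (¬Meet-in-packing s₁∈ s₂∈ (λ ()) (Near⇒Meet 2a≤b near 1≤2a 2≤2a))

    maximal-size : suc b ≤ length S * suc (2 * a)
    maximal-size = covering-bound a (length S) (proj₁ ∘ lookup S) (suc b)
      (λ c< → let covered = maximal⇒covering (s≤s⁻¹ c<) in Any.index covered , lookup-index covered)

  FixedPacking⇒size : 0 < a → 2 * a < b → ∀ {vs} → FixedPacking (T a b) vs →
                      suc (b / suc (2 * a)) ≤ length vs
  FixedPacking⇒size 0<a 2a<b ((in-board , disjoint) , maximal)
    with S , refl , fits ← OnBoard⇒Fits* in-board =
    ≤-trans (*-cancelʳ-< (suc (2 * a)) (b / suc (2 * a)) (length S)
               (≤-trans (s≤s (m/n*n≤m b (suc (2 * a))))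
                        (maximal-size 0<a 2a<b fits (AllPairs.map⁻ disjoint) maximal)))
            (≤-reflexive (sym (length-map place S)))

  module Greedy where
    m q L : ℕ
    m = suc (2 * a)
    q = b / m
    L = b ⊓ (a + q * m)

    regular : ℕ → Placement
    regular i = (a + i * m , 0)

    greedy : List Placement
    greedy = (L , 1) ∷ map regular (upTo q)

    length-greedy : length (map place greedy) ≡ suc q
    length-greedy = cong suc (trans (length-map place (map regular (upTo q)))
                                    (trans (length-map regular (upTo q)) (length-upTo q)))

    L≤b : L ≤ b
    L≤b = m⊓n≤m b (a + q * m)

    qm≤L : q * m ≤ L
    qm≤L = ⊓-glb (m/n*n≤m b m) (m≤n+m (q * m) a)

    n≤a+[n/m]*m+a : ∀ n → n ≤ a + n / m * m + a
    n≤a+[n/m]*m+a n = begin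
      n                 ≡⟨ m≡m%n+[m/n]*n n m ⟩
      n % m + n / m * m ≤⟨ +-monoˡ-≤ (n / m * m) (s≤s⁻¹ (m%n<n n m)) ⟩
      2 * a + n / m * m ≡⟨ shuffle a (n / m * m) ⟩
      a + n / m * m + a ∎
      where
      open ≤-Reasoning
      shuffle : ∀ a k → 2 * a + k ≡ a + k + a
      shuffle = solve-∀

    b≤L+a : b ≤ L + a
    b≤L+a = begin
      b                         ≤⟨ ⊓-glb (m≤m+n b a) (n≤a+[n/m]*m+a b) ⟩
      (b + a) ⊓ (a + q * m + a) ≡⟨ +-distribʳ-⊓ a b (a + q * m) ⟨
      L + a                     ∎
      where open ≤-Reasoning

    regular-near : ∀ c → Near a c (a + c / m * m)
    regular-near c = n≤a+[n/m]*m+a c , ≤-trans (≤-reflexive (+-comm a (c / m * m))) (+-monoˡ-≤ a (m/n*n≤m c m))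

    regular-below-L : ∀ {i} → i < q → a + i * m + a < L
    regular-below-L {i} i<q = begin-strict
      a + i * m + a ≡⟨ shuffle a (i * m) ⟩
      2 * a + i * m <⟨ ≤-refl ⟩
      suc i * m     ≤⟨ *-monoˡ-≤ m i<q ⟩
      q * m         ≤⟨ qm≤L ⟩
      L             ∎
      where
      open ≤-Reasoning
      shuffle : ∀ a k → a + k + a ≡ 2 * a + k
      shuffle = solve-∀

    regular-apart : ∀ {i j} → i < j → ¬ Near (2 * a) (a + i * m) (a + j * m)
    regular-apart {i} {j} i<j (_ , j≤) = <⇒≱ (begin-strict
      a + i * m + 2 * a       <⟨ n<1+n _ ⟩
      suc (a + i * m + 2 * a) ≡⟨ shuffle a (i * m) ⟩
      a + suc i * m           ≤⟨ +-monoʳ-≤ a (*-monoˡ-≤ m i<j) ⟩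
      a + j * m               ∎) j≤
      where
      open ≤-Reasoning
      shuffle : ∀ a k → suc (a + k + 2 * a) ≡ a + (suc (2 * a) + k)
      shuffle = solve-∀

    greedy-fits : 0 < a → All Fits greedy
    greedy-fits 0<a = (L≤b , ≤-trans 0<a a≤2a) ∷ All.map⁺ (All.tabulate (λ i∈ → regular-fits (∈-upTo⁻ i∈)))
      where
      regular-fits : ∀ {i} → i < q → Fits (regular i)
      regular-fits i<q = ≤-trans (m≤m+n _ a) (<⇒≤ (<-≤-trans (regular-below-L i<q) L≤b)) , z≤n

    greedy-covers : ∀ {c} → c ≤ b → Any (Near a c ∘ proj₁) greedy
    greedy-covers {c} c≤b with q * m ≤? c
    ... | yes qm≤c = here (≤-trans c≤b b≤L+a ,
                           ≤-trans (m⊓n≤n b (a + q * m)) (≤-trans (+-monoʳ-≤ a qm≤c) (≤-reflexive (+-comm a c))))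
    ... | no qm≰c = there (lose (∈-map⁺ regular (∈-upTo⁺ (m<n*o⇒m/o<n (≰⇒> qm≰c)))) (regular-near c))

    greedy-disjoint : AllPairs Disjoint greedy
    greedy-disjoint =
      All.map⁺ (All.tabulate (λ i∈ → ¬Clash⇒Disjoint [ <⇒≱ (regular-below-L (∈-upTo⁻ i∈)) ∘ proj₁ , (λ ()) ∘ proj₁ ])) ∷
      AllPairs.map⁺ (AllPairs.applyUpTo⁺₁ _ q (λ i<j _ →
        ¬Clash⇒Disjoint [ regular-apart i<j ∘ Near-mono a≤2a , regular-apart i<j ∘ proj₂ ]))

    greedy-packing : 0 < a → 2 * a < b → FixedPacking (T a b) (map place greedy)
    greedy-packing 0<a 2a<b =
      (All.map⁺ (All.map Fits⇒OnBoard (greedy-fits 0<a)) , AllPairs.map⁺ greedy-disjoint) ,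
      covering⇒maximal (<⇒≤ 2a<b) (greedy-fits 0<a) greedy-covers

⌈b+1/m⌉≡1+⌊b/m⌋ : ∀ a b → (b + 1 + 2 * a) / suc (2 * a) ≡ suc (b / suc (2 * a))
⌈b+1/m⌉≡1+⌊b/m⌋ a b = begin
  (b + 1 + 2 * a) / m ≡⟨ /-congˡ (shuffle a b) ⟩
  (b + m) / m         ≡⟨ +-distrib-/-∣ʳ b ∣-refl ⟩
  b / m + m / m       ≡⟨ cong (_+_ (b / m)) (n/n≡1 m) ⟩
  b / m + 1           ≡⟨ +-comm (b / m) 1 ⟩
  suc (b / m)         ∎
  where
  open ≡-Reasoning
  m = suc (2 * a)
  shuffle : ∀ a b → b + 1 + 2 * a ≡ b + suc (2 * a)
  shuffle = solve-∀

theorem3p15 : (a b : ℕ) → 0 < a → 0 < b → 2 * a < b →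
    IsClumsyFixedPackingNumber (T a b) ((b + 1 + 2 * a) / suc (2 * a))
theorem3p15 a b 0<a _ 2a<b rewrite ⌈b+1/m⌉≡1+⌊b/m⌋ a b =
  (map place greedy , greedy-packing 0<a 2a<b , length-greedy) ,
  λ _ → FixedPacking⇒size a b 0<a 2a<b
  where open Greedy a b
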